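{- Let $p$ be an odd prime, $L=\langle -1,2\rangle\le\mathbb{Z}_p^{\times}$, and $\ell=[\mathbb{Z}_p^{\times}:L]$. Let $g$ be a primitive root of $\mathbb{Z}_p$, $A(i,j)=|(1+g^iL)\cap g^jL|$ for integers $i,j$, and $s(\ell)=\sum_{1\le i\le\ell,\ \gcd(i,\ell)=1}A(i,2i)$. If $\ell$ is an odd prime, then the number of squares of $\mathbb{Z}_p$ (including $0$) lying in $1+L$ equals $\frac12\left(1+A(0,0)+s(\ell)\right)$.
   Context: $\mathbb{Z}_p=\mathbb{Z}/p\mathbb{Z}$, $\mathbb{Z}_p^{\times}=\mathbb{Z}_p\setminus\{0\}$; $\langle -1,2\rangle$ is the subgroup generated by $-1$ and $2$. A primitive root is a generator of $\mathbb{Z}_p^{\times}$. An element $x\in\mathbb{Z}_p$ is a square if $x=r^2$ for some $r\in\mathbb{Z}_p$. For $S\subseteq\mathbb{Z}_p$, $a+S=\{a+s:s\in S\}$, $aS=\{as:s\in S\}$. -}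

module Defs where

open import Data.Nat using (ℕ; zero; suc; _+_; _*_; _∸_; NonZero)
open import Data.Nat.DivMod using (_mod_)
open import Data.Nat.GCD using (gcd)
open import Data.Nat.Properties using (_≟_)
open import Data.Fin using (Fin; toℕ)
open import Data.List using (List; length; map; applyUpTo)
open import Data.Nat.ListAction using (sum)
open import Data.List.Membership.Propositional using (_∈_)
open import Data.List.Relation.Unary.Unique.Propositional using (Unique)
open import Data.Product using (Σ; ∃; _×_)
open import Relation.Binary.PropositionalEquality using (_≡_)
open import Relation.Nullary using (does)
open import Data.Bool using (if_then_else_)
open import Data.Empty using (⊥)

module Zp (p : ℕ) .{{_ : NonZero p}} where
  Z : Set
  Z = Fin p

  fromN : ℕ → Z
  fromN n = n mod p

  _⊕_ : Z → Z → Z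
  x ⊕ y = (toℕ x + toℕ y) mod p

  _⊗_ : Z → Z → Z
  x ⊗ y = (toℕ x * toℕ y) mod p

  ⊖_ : Z → Z
  ⊖ x = (p ∸ toℕ x) mod p

  _^^_ : Z → ℕ → Z
  x ^^ zero = fromN 1
  x ^^ suc k = x ⊗ (x ^^ k)

  Subset : Set₁
  Subset = Z → Set

  _+ˢ_ : Z → Subset → Subset
  (a +ˢ S) x = ∃ λ s → S s × x ≡ a ⊕ s

  _·ˢ_ : Z → Subset → Subset
  (a ·ˢ S) x = ∃ λ s → S s × x ≡ a ⊗ s

  _∩ˢ_ : Subset → Subset → Subset
  (S ∩ˢ T) x = S x × T x

  -- L = ⟨-1, 2⟩ : the subgroup of ℤ_p^× generated by -1 and 2
  -- (p odd prime, so both are units; in a finite group the generated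
  --  subgroup consists of the products (-1)^a 2^k with a, k ∈ ℕ)
  L : Subset
  L x = ∃ λ a → ∃ λ k → x ≡ ((⊖ fromN 1) ^^ a) ⊗ (fromN 2 ^^ k)

  IsSquare : Subset
  IsSquare x = ∃ λ r → x ≡ r ⊗ r

  IsPrimitiveRoot : Z → Set
  IsPrimitiveRoot g = ∀ (x : Z) → (x ≡ fromN 0 → ⊥) → ∃ λ k → x ≡ g ^^ k

  HasCard : Subset → ℕ → Set
  HasCard S n = Σ (List Z) λ xs →
    Unique xs × (∀ x → (x ∈ xs → S x) × (S x → x ∈ xs)) × length xs ≡ n

sℓ : (ℕ → ℕ → ℕ) → ℕ → ℕ
sℓ A ℓ = sum (map (λ i → if does (gcd i ℓ ≟ 1) then A i (2 * i) else 0) (applyUpTo suc ℓ))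

module Submission where

-- Every nonzero square has two square roots and 0 has one; as 0 = 1 + (−1) ∈ 1 + L, 2N − 1
-- counts the r with r² ∈ 1 + L. The involution F t = (t + 1)/(t − 1) maps these r bijectively
-- onto the disjoint union of the blocks (1 + gⁱL) ∩ g²ⁱL, 0 ≤ i < ℓ: writing F r = 1 + x one has
-- r² = 1 + 4(1 + x)/x², and for x ∈ gⁱL this lies in 1 + L exactly when 1 + x ∈ g²ⁱL. For prime ℓ
-- the indices 0 < i < ℓ are exactly those coprime to ℓ, so the block sizes sum to A(0,0) + s(ℓ).

open import Defs
open import Algebra.Bundles using (CommutativeRing)
open import Algebra.Structures using (IsCommutativeRing)
open import Data.Bool using (if_then_else_)
open import Data.Empty using (⊥; ⊥-elim)
open import Data.Fin as Fin using (Fin; toℕ)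
open import Data.Fin.Properties using (toℕ-injective; toℕ-fromℕ<; toℕ<n; suc-injective; punchOut-injective; pigeonhole)
open import Data.List using (List; []; _∷_; _++_; _∷ʳ_; length; map; allFin; applyUpTo)
open import Data.List.Properties using (length-++; length-map; length-tabulate; length-applyUpTo; map-applyUpTo; applyUpTo-∷ʳ)
open import Data.List.Membership.Propositional using (_∈_; _∉_)
open import Data.List.Membership.Propositional.Properties
  using (∈-∃++; ∈-++⁻; ∈-++⁺ˡ; ∈-++⁺ʳ; ∈-map⁺; ∈-map⁻; ∈-applyUpTo⁺; ∈-applyUpTo⁻)
open import Data.List.Relation.Binary.Subset.Propositional using (_⊆_)
open import Data.List.Relation.Unary.All as All using (All; []; _∷_)
open import Data.List.Relation.Unary.AllPairs using ([]; _∷_)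
open import Data.List.Relation.Unary.Any using (here; there; any?)
open import Data.List.Relation.Unary.Unique.Propositional using (Unique)
import Data.List.Relation.Unary.Unique.Propositional.Properties as Unique
open import Data.Maybe using (nothing)
open import Data.Nat as ℕ
  using (ℕ; zero; suc; _+_; _*_; _∸_; _≤_; _<_; _%_; _/_; NonZero; NonTrivial; z≤n; s≤s; z<s; s<s)
open import Data.Nat.DivMod
  using (m≡m%n+[m/n]*n; %-distribˡ-+; %-distribˡ-*; m%n%n≡m%n; m<n⇒m%n≡m; n%n≡0; m%n<n; m*[n/m]≡n)
open import Data.Nat.Divisibility using (_∣_; ∣⇒≤; ∣-refl; m%n≡0⇒n∣m; n∣m⇒m%n≡0)
open import Data.Nat.GCD using (gcd; gcd[m,n]∣m; gcd[m,n]∣n)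
open import Data.Nat.Coprimality using (gcd≡1⇒coprime)
open import Data.Nat.ListAction using (sum)
open import Data.Nat.ListAction.Properties using (sum-++)
open import Data.Nat.Primality using (Prime; euclidsLemma; prime⇒irreducible; prime⇒nonZero; prime⇒nonTrivial)
import Data.Nat.Properties as ℕ
open import Data.Product using (∃; _×_; _,_; proj₁; proj₂)
open import Data.Sum as Sum using (_⊎_; inj₁; inj₂)
open import Function using (id; _∘_; _⇔_; mk⇔; Equivalence)
open import Relation.Binary.Bundles using (Setoid)
open import Relation.Binary.PropositionalEquality as ≡
  using (_≡_; _≢_; refl; sym; trans; cong; cong₂; subst; subst₂)
open import Relation.Nullary using (¬_; yes; no; does)
open import Relation.Nullary.Decidable using (_×-dec_; map′; dec-true; dec-false)
open import Relation.Unary using (Decidable)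
import Algebra.Properties.CommutativeSemiring.Exp as Exp
import Algebra.Properties.Group as GroupProperties
import Algebra.Properties.Ring as RingProperties
import Relation.Binary.Reasoning.Setoid as SetoidReasoning
open import Tactic.RingSolver.Core.AlmostCommutativeRing using (fromCommutativeRing)
import Tactic.RingSolver.NonReflective as RingSolver

module _ {a} {A : Set a} where

  Unique∧⊆⇒length≤ : ∀ {xs ys : List A} → Unique xs → xs ⊆ ys → length xs ≤ length ys
  Unique∧⊆⇒length≤ {[]} _ _ = z≤n
  Unique∧⊆⇒length≤ {x ∷ xs} (x∉xs ∷ xs!) xs⊆ys
    with ys₁ , ys₂ , refl ← ∈-∃++ (xs⊆ys (here refl)) =
    subst (suc (length xs) ≤_) (sym length-ys)
      (s≤s (Unique∧⊆⇒length≤ xs! λ z∈xs → drop-x z∈xs (xs⊆ys (there z∈xs))))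
    where
    length-ys : length (ys₁ ++ x ∷ ys₂) ≡ suc (length (ys₁ ++ ys₂))
    length-ys = trans (length-++ ys₁) (trans (ℕ.+-suc (length ys₁) _) (cong suc (sym (length-++ ys₁))))
    drop-x : ∀ {z} → z ∈ xs → z ∈ ys₁ ++ x ∷ ys₂ → z ∈ ys₁ ++ ys₂
    drop-x z∈xs z∈ys with ∈-++⁻ ys₁ z∈ys
    ... | inj₁ z∈ys₁         = ∈-++⁺ˡ z∈ys₁
    ... | inj₂ (here refl)   = ⊥-elim (All.lookup x∉xs z∈xs refl)
    ... | inj₂ (there z∈ys₂) = ∈-++⁺ʳ ys₁ z∈ys₂

  Unique∧⊆∧⊇⇒length≡ : ∀ {xs ys : List A} → Unique xs → Unique ys → xs ⊆ ys → ys ⊆ xs →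
                       length xs ≡ length ys
  Unique∧⊆∧⊇⇒length≡ xs! ys! xs⊆ys ys⊆xs =
    ℕ.≤-antisym (Unique∧⊆⇒length≤ xs! xs⊆ys) (Unique∧⊆⇒length≤ ys! ys⊆xs)

applyUpTo-cong : ∀ {a} {A : Set a} {f g : ℕ → A} n → (∀ {i} → i < n → f i ≡ g i) →
                 applyUpTo f n ≡ applyUpTo g n
applyUpTo-cong zero    f≗g = refl
applyUpTo-cong (suc n) f≗g = cong₂ _∷_ (f≗g z<s) (applyUpTo-cong n (f≗g ∘ s<s))

module _ {p} {P : ℕ → Set p} (P? : Decidable P) where

  least-witness : ∀ {n} → P n → ∃ λ m → P m × (∀ {j} → j < m → ¬ P j)
  least-witness {n} = search (suc n) n (ℕ.n<1+n n)
    where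
    search : ∀ b n → n < b → P n → ∃ λ m → P m × (∀ {j} → j < m → ¬ P j)
    search (suc b) n n<1+b Pn with ℕ.anyUpTo? P? n
    ... | no ∄j = n , Pn , λ j<n Pj → ∄j (_ , j<n , Pj)
    ... | yes (j , j<n , Pj) = search b j (ℕ.<-≤-trans j<n (ℕ.s≤s⁻¹ n<1+b)) Pj

module ℤₚ-Ring (p : ℕ) .{{_ : NonZero p}} where
  open Zp p

  0ᶻ 1ᶻ 2ᶻ 4ᶻ : Z
  0ᶻ = fromN 0
  1ᶻ = fromN 1
  2ᶻ = fromN 2
  4ᶻ = 2ᶻ ⊗ 2ᶻ

  private
    -- Congruence modulo p; the record keeps both sides inferable.
    infix 4 _≋_
    record _≋_ (a b : ℕ) : Set where
      constructor mod-eq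
      field %-eq : a % p ≡ b % p
    open _≋_

    ≋-setoid : Setoid _ _
    ≋-setoid = record
      { Carrier = ℕ
      ; _≈_ = _≋_
      ; isEquivalence = record
        { refl = mod-eq refl
        ; sym = λ a≋b → mod-eq (sym (%-eq a≋b))
        ; trans = λ a≋b b≋c → mod-eq (trans (%-eq a≋b) (%-eq b≋c)) } }

    open Setoid ≋-setoid using () renaming (refl to ≋-refl)
    module ≋-Reasoning = SetoidReasoning ≋-setoid

    +-cong : ∀ {a b c d} → a ≋ b → c ≋ d → a + c ≋ b + d
    +-cong {a} {b} {c} {d} (mod-eq a≋b) (mod-eq c≋d) = mod-eq (begin
      (a + c) % p             ≡⟨ %-distribˡ-+ a c p ⟩
      (a % p + c % p) % p     ≡⟨ cong₂ (λ u v → (u + v) % p) a≋b c≋d ⟩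
      (b % p + d % p) % p     ≡⟨ %-distribˡ-+ b d p ⟨
      (b + d) % p             ∎)
      where open ≡.≡-Reasoning

    *-cong : ∀ {a b c d} → a ≋ b → c ≋ d → a * c ≋ b * d
    *-cong {a} {b} {c} {d} (mod-eq a≋b) (mod-eq c≋d) = mod-eq (begin
      (a * c) % p             ≡⟨ %-distribˡ-* a c p ⟩
      (a % p * (c % p)) % p   ≡⟨ cong₂ (λ u v → (u * v) % p) a≋b c≋d ⟩
      (b % p * (d % p)) % p   ≡⟨ %-distribˡ-* b d p ⟨
      (b * d) % p             ∎)
      where open ≡.≡-Reasoning

    0%p≡0 : 0 % p ≡ 0
    0%p≡0 = m<n⇒m%n≡m (ℕ.>-nonZero⁻¹ p)

    toℕ-fromN : ∀ a → toℕ (fromN a) ≋ a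
    toℕ-fromN a = mod-eq (trans (cong (_% p) (toℕ-fromℕ< _)) (m%n%n≡m%n a p))

    toℕ-⊕ : ∀ x y → toℕ (x ⊕ y) ≋ toℕ x + toℕ y
    toℕ-⊕ x y = toℕ-fromN _

    toℕ-⊗ : ∀ x y → toℕ (x ⊗ y) ≋ toℕ x * toℕ y
    toℕ-⊗ x y = toℕ-fromN _

    ≋⇒≡ : ∀ {x y : Z} → toℕ x ≋ toℕ y → x ≡ y
    ≋⇒≡ {x} {y} (mod-eq eq) =
      toℕ-injective (trans (sym (m<n⇒m%n≡m (toℕ<n x))) (trans eq (m<n⇒m%n≡m (toℕ<n y))))

  ⊕-assoc : ∀ x y z → (x ⊕ y) ⊕ z ≡ x ⊕ (y ⊕ z)
  ⊕-assoc x y z = ≋⇒≡ (begin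
    toℕ ((x ⊕ y) ⊕ z)          ≈⟨ toℕ-⊕ (x ⊕ y) z ⟩
    toℕ (x ⊕ y) + toℕ z        ≈⟨ +-cong (toℕ-⊕ x y) ≋-refl ⟩
    toℕ x + toℕ y + toℕ z      ≡⟨ ℕ.+-assoc (toℕ x) (toℕ y) (toℕ z) ⟩
    toℕ x + (toℕ y + toℕ z)    ≈⟨ +-cong (≋-refl {toℕ x}) (toℕ-⊕ y z) ⟨
    toℕ x + toℕ (y ⊕ z)        ≈⟨ toℕ-⊕ x (y ⊕ z) ⟨
    toℕ (x ⊕ (y ⊕ z))          ∎)
    where open ≋-Reasoning

  ⊗-assoc : ∀ x y z → (x ⊗ y) ⊗ z ≡ x ⊗ (y ⊗ z)
  ⊗-assoc x y z = ≋⇒≡ (begin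
    toℕ ((x ⊗ y) ⊗ z)          ≈⟨ toℕ-⊗ (x ⊗ y) z ⟩
    toℕ (x ⊗ y) * toℕ z        ≈⟨ *-cong (toℕ-⊗ x y) ≋-refl ⟩
    toℕ x * toℕ y * toℕ z      ≡⟨ ℕ.*-assoc (toℕ x) (toℕ y) (toℕ z) ⟩
    toℕ x * (toℕ y * toℕ z)    ≈⟨ *-cong (≋-refl {toℕ x}) (toℕ-⊗ y z) ⟨
    toℕ x * toℕ (y ⊗ z)        ≈⟨ toℕ-⊗ x (y ⊗ z) ⟨
    toℕ (x ⊗ (y ⊗ z))          ∎)
    where open ≋-Reasoning

  ⊕-comm : ∀ x y → x ⊕ y ≡ y ⊕ x
  ⊕-comm x y = cong fromN (ℕ.+-comm (toℕ x) (toℕ y))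

  ⊗-comm : ∀ x y → x ⊗ y ≡ y ⊗ x
  ⊗-comm x y = cong fromN (ℕ.*-comm (toℕ x) (toℕ y))

  ⊕-identityˡ : ∀ x → 0ᶻ ⊕ x ≡ x
  ⊕-identityˡ x = ≋⇒≡ (begin
    toℕ (0ᶻ ⊕ x)               ≈⟨ toℕ-⊕ 0ᶻ x ⟩
    toℕ 0ᶻ + toℕ x             ≈⟨ +-cong (toℕ-fromN 0) ≋-refl ⟩
    0 + toℕ x                  ≡⟨⟩
    toℕ x                      ∎)
    where open ≋-Reasoning

  ⊗-identityˡ : ∀ x → 1ᶻ ⊗ x ≡ x
  ⊗-identityˡ x = ≋⇒≡ (begin
    toℕ (1ᶻ ⊗ x)               ≈⟨ toℕ-⊗ 1ᶻ x ⟩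
    toℕ 1ᶻ * toℕ x             ≈⟨ *-cong (toℕ-fromN 1) ≋-refl ⟩
    1 * toℕ x                  ≡⟨ ℕ.*-identityˡ (toℕ x) ⟩
    toℕ x                      ∎)
    where open ≋-Reasoning

  ⊖-inverseˡ : ∀ x → (⊖ x) ⊕ x ≡ 0ᶻ
  ⊖-inverseˡ x = ≋⇒≡ (begin
    toℕ ((⊖ x) ⊕ x)            ≈⟨ toℕ-⊕ (⊖ x) x ⟩
    toℕ (⊖ x) + toℕ x          ≈⟨ +-cong (toℕ-fromN (p ∸ toℕ x)) ≋-refl ⟩
    p ∸ toℕ x + toℕ x          ≡⟨ ℕ.m∸n+n≡m (ℕ.<⇒≤ (toℕ<n x)) ⟩
    p                          ≈⟨ mod-eq (trans (n%n≡0 p) (sym 0%p≡0)) ⟩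
    0                          ≈⟨ toℕ-fromN 0 ⟨
    toℕ 0ᶻ                     ∎)
    where open ≋-Reasoning

  ⊗-distribˡ-⊕ : ∀ x y z → x ⊗ (y ⊕ z) ≡ (x ⊗ y) ⊕ (x ⊗ z)
  ⊗-distribˡ-⊕ x y z = ≋⇒≡ (begin
    toℕ (x ⊗ (y ⊕ z))                ≈⟨ toℕ-⊗ x (y ⊕ z) ⟩
    toℕ x * toℕ (y ⊕ z)              ≈⟨ *-cong (≋-refl {toℕ x}) (toℕ-⊕ y z) ⟩
    toℕ x * (toℕ y + toℕ z)          ≡⟨ ℕ.*-distribˡ-+ (toℕ x) (toℕ y) (toℕ z) ⟩
    toℕ x * toℕ y + toℕ x * toℕ z    ≈⟨ +-cong (toℕ-⊗ x y) (toℕ-⊗ x z) ⟨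
    toℕ (x ⊗ y) + toℕ (x ⊗ z)        ≈⟨ toℕ-⊕ (x ⊗ y) (x ⊗ z) ⟨
    toℕ ((x ⊗ y) ⊕ (x ⊗ z))          ∎)
    where open ≋-Reasoning

  isCommutativeRing : IsCommutativeRing _≡_ _⊕_ _⊗_ ⊖_ 0ᶻ 1ᶻ
  isCommutativeRing = record
    { isRing = record
      { +-isAbelianGroup = record
        { isGroup = record
          { isMonoid = record
            { isSemigroup = record
              { isMagma = record { isEquivalence = ≡.isEquivalence ; ∙-cong = cong₂ _⊕_ }
              ; assoc = ⊕-assoc }
            ; identity = ⊕-identityˡ , λ x → trans (⊕-comm x 0ᶻ) (⊕-identityˡ x) }
          ; inverse = ⊖-inverseˡ , λ x → trans (⊕-comm x (⊖ x)) (⊖-inverseˡ x)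
          ; ⁻¹-cong = cong ⊖_ }
        ; comm = ⊕-comm }
      ; *-cong = cong₂ _⊗_
      ; *-assoc = ⊗-assoc
      ; *-identity = ⊗-identityˡ , λ x → trans (⊗-comm x 1ᶻ) (⊗-identityˡ x)
      ; distrib = ⊗-distribˡ-⊕ , λ x y z → trans (⊗-comm (y ⊕ z) x)
                    (trans (⊗-distribˡ-⊕ x y z) (cong₂ _⊕_ (⊗-comm x y) (⊗-comm x z))) }
    ; *-comm = ⊗-comm }

  commutativeRing : CommutativeRing _ _
  commutativeRing = record { isCommutativeRing = isCommutativeRing }

  open CommutativeRing commutativeRing public
    using (_-_; +-group; ring; +-identityʳ; *-identityʳ; -‿inverseʳ; distribʳ)
  open GroupProperties +-group public using (x∙y⁻¹≈ε⇒x≈y; inverseˡ-unique; ⁻¹-involutive)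
  open RingProperties ring public using (+-cancelˡ; +-cancelʳ; x[y-z]≈xy-xz; -‿distribˡ-*; -‿distribʳ-*)
  open RingSolver (fromCommutativeRing commutativeRing (λ _ → nothing)) public
    using (solve; _⊜_; Κ) renaming (_⊕_ to _:+_; _⊗_ to _:*_; ⊝_ to :-_)

  fromN-injective : ∀ {a b} → a < p → b < p → fromN a ≡ fromN b → a ≡ b
  fromN-injective {a} {b} a<p b<p eq = begin
    a                   ≡⟨ m<n⇒m%n≡m a<p ⟨
    a % p               ≡⟨ %-eq (toℕ-fromN a) ⟨
    toℕ (fromN a) % p   ≡⟨ cong (λ x → toℕ x % p) eq ⟩
    toℕ (fromN b) % p   ≡⟨ %-eq (toℕ-fromN b) ⟩
    b % p               ≡⟨ m<n⇒m%n≡m b<p ⟩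
    b                   ∎
    where open ≡.≡-Reasoning

  ≡0ᶻ⇒∣ : ∀ a → fromN a ≡ 0ᶻ → p ∣ a
  ≡0ᶻ⇒∣ a eq = m%n≡0⇒n∣m a p (begin
    a % p               ≡⟨ %-eq (toℕ-fromN a) ⟨
    toℕ (fromN a) % p   ≡⟨ cong (λ x → toℕ x % p) eq ⟩
    toℕ 0ᶻ % p          ≡⟨ %-eq (toℕ-fromN 0) ⟩
    0 % p               ≡⟨ 0%p≡0 ⟩
    0                   ∎)
    where open ≡.≡-Reasoning

  ∣⇒≡0ᶻ : ∀ x → p ∣ toℕ x → x ≡ 0ᶻ
  ∣⇒≡0ᶻ x p∣x = ≋⇒≡ (mod-eq (begin
    toℕ x % p           ≡⟨ n∣m⇒m%n≡0 _ p p∣x ⟩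
    0                   ≡⟨ 0%p≡0 ⟨
    0 % p               ≡⟨ %-eq (toℕ-fromN 0) ⟨
    toℕ 0ᶻ % p          ∎))
    where open ≡.≡-Reasoning

  open Exp (CommutativeRing.commutativeSemiring commutativeRing) using (_^_; ^-homo-*; ^-assocʳ)

  private
    ^^≡^ : ∀ x n → x ^^ n ≡ x ^ n
    ^^≡^ x zero    = refl
    ^^≡^ x (suc n) = cong (x ⊗_) (^^≡^ x n)

  ^^-homo-⊗ : ∀ x m n → x ^^ (m + n) ≡ (x ^^ m) ⊗ (x ^^ n)
  ^^-homo-⊗ x m n =
    trans (^^≡^ x (m + n)) (trans (^-homo-* x m n) (sym (cong₂ _⊗_ (^^≡^ x m) (^^≡^ x n))))

  ^^-assocʳ : ∀ x m n → (x ^^ m) ^^ n ≡ x ^^ (m * n)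
  ^^-assocʳ x m n = begin
    (x ^^ m) ^^ n   ≡⟨ ^^≡^ (x ^^ m) n ⟩
    (x ^^ m) ^ n    ≡⟨ cong (_^ n) (^^≡^ x m) ⟩
    (x ^ m) ^ n     ≡⟨ ^-assocʳ x m n ⟩
    x ^ (m * n)     ≡⟨ ^^≡^ x (m * n) ⟨
    x ^^ (m * n)    ∎
    where open ≡.≡-Reasoning

  1^^n≡1 : ∀ n → 1ᶻ ^^ n ≡ 1ᶻ
  1^^n≡1 zero    = refl
  1^^n≡1 (suc n) = trans (⊗-identityˡ _) (1^^n≡1 n)

  ^^-double : ∀ x n → x ^^ (2 * n) ≡ (x ^^ n) ⊗ (x ^^ n)
  ^^-double x n = trans (cong (λ k → x ^^ (n + k)) (ℕ.+-identityʳ n)) (^^-homo-⊗ x n n)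

  ^^-divMod : ∀ x e d .{{_ : NonZero d}} → x ^^ e ≡ (x ^^ (e % d)) ⊗ ((x ^^ d) ^^ (e / d))
  ^^-divMod x e d = begin
    x ^^ e                                   ≡⟨ cong (x ^^_) (m≡m%n+[m/n]*n e d) ⟩
    x ^^ (e % d + e / d * d)                 ≡⟨ ^^-homo-⊗ x (e % d) (e / d * d) ⟩
    (x ^^ (e % d)) ⊗ (x ^^ (e / d * d))      ≡⟨ cong (λ k → (x ^^ (e % d)) ⊗ (x ^^ k)) (ℕ.*-comm (e / d) d) ⟩
    (x ^^ (e % d)) ⊗ (x ^^ (d * (e / d)))    ≡⟨ cong ((x ^^ (e % d)) ⊗_) (^^-assocʳ x d (e / d)) ⟨
    (x ^^ (e % d)) ⊗ ((x ^^ d) ^^ (e / d))   ∎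
    where open ≡.≡-Reasoning

  ^^-mod : ∀ {x c} .{{_ : NonZero c}} → x ^^ c ≡ 1ᶻ → ∀ e → x ^^ e ≡ x ^^ (e % c)
  ^^-mod {x} {c} xᶜ≡1 e = begin
    x ^^ e                                   ≡⟨ ^^-divMod x e c ⟩
    (x ^^ (e % c)) ⊗ ((x ^^ c) ^^ (e / c))   ≡⟨ cong (λ y → (x ^^ (e % c)) ⊗ (y ^^ (e / c))) xᶜ≡1 ⟩
    (x ^^ (e % c)) ⊗ (1ᶻ ^^ (e / c))         ≡⟨ cong ((x ^^ (e % c)) ⊗_) (1^^n≡1 (e / c)) ⟩
    (x ^^ (e % c)) ⊗ 1ᶻ                      ≡⟨ *-identityʳ _ ⟩
    x ^^ (e % c)                             ∎
    where open ≡.≡-Reasoning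

module Cardinality (p : ℕ) .{{_ : NonZero p}} where
  open Zp p

  HasCard-length : ∀ {S n} {xs : List Z} → HasCard S n → Unique xs →
                   (∀ x → x ∈ xs → S x) → (∀ x → S x → x ∈ xs) → length xs ≡ n
  HasCard-length (ys , ys! , ys≐S , refl) xs! xs⊆S S⊆xs = Unique∧⊆∧⊇⇒length≡ xs! ys!
    (λ {x} x∈xs → proj₂ (ys≐S x) (xs⊆S x x∈xs)) (λ {y} y∈ys → S⊆xs y (proj₁ (ys≐S y) y∈ys))

  HasCard-functional : ∀ {S m n} → HasCard S m → HasCard S n → m ≡ n
  HasCard-functional (xs , xs! , xs≐S , refl) |S| =
    HasCard-length |S| xs! (λ x → proj₁ (xs≐S x)) (λ x → proj₂ (xs≐S x))

  HasCard-resp : ∀ {S T n} → (∀ x → S x → T x) → (∀ x → T x → S x) → HasCard S n → HasCard T n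
  HasCard-resp S⇒T T⇒S (xs , xs! , xs≐S , |xs|≡n) =
    xs , xs! , (λ x → S⇒T x ∘ proj₁ (xs≐S x) , proj₂ (xs≐S x) ∘ T⇒S x) , |xs|≡n

  HasCard-image : ∀ {S T n} (f : Z → Z) → (∀ {x y} → f x ≡ f y → x ≡ y) →
                  (∀ x → S x → T (f x)) → (∀ y → T y → ∃ λ x → S x × y ≡ f x) →
                  HasCard S n → HasCard T n
  HasCard-image {S} {T} f f-injective S⇒T T⇒S (xs , xs! , xs≐S , refl) =
    map f xs , Unique.map⁺ f-injective xs! , (λ y → image⇒T y , T⇒image y) , length-map f xs
    where
    image⇒T : ∀ y → y ∈ map f xs → T y
    image⇒T y y∈fxs with x , x∈xs , refl ← ∈-map⁻ f y∈fxs = S⇒T x (proj₁ (xs≐S x) x∈xs)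
    T⇒image : ∀ y → T y → y ∈ map f xs
    T⇒image y Ty with x , Sx , refl ← T⇒S y Ty = ∈-map⁺ f (proj₂ (xs≐S x) Sx)

  HasCard-⊎ : ∀ {S T m n} → HasCard S m → HasCard T n → (∀ {x} → S x → T x → ⊥) →
              HasCard (λ x → S x ⊎ T x) (m + n)
  HasCard-⊎ {S} {T} (xs , xs! , xs≐S , refl) (ys , ys! , ys≐T , refl) S∩T≡∅ =
    xs ++ ys , Unique.++⁺ xs! ys! disjoint , (λ z → ++⇒⊎ z , ⊎⇒++ z) , length-++ xs
    where
    disjoint : ∀ {z} → ¬ (z ∈ xs × z ∈ ys)
    disjoint {z} (z∈xs , z∈ys) = S∩T≡∅ (proj₁ (xs≐S z) z∈xs) (proj₁ (ys≐T z) z∈ys)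
    ++⇒⊎ : ∀ z → z ∈ xs ++ ys → S z ⊎ T z
    ++⇒⊎ z = Sum.map (proj₁ (xs≐S z)) (proj₁ (ys≐T z)) ∘ ∈-++⁻ xs
    ⊎⇒++ : ∀ z → S z ⊎ T z → z ∈ xs ++ ys
    ⊎⇒++ z (inj₁ Sz) = ∈-++⁺ˡ (proj₂ (xs≐S z) Sz)
    ⊎⇒++ z (inj₂ Tz) = ∈-++⁺ʳ xs (proj₂ (ys≐T z) Tz)

  HasCard-⋃ : ∀ (S : ℕ → Subset) {c : ℕ → ℕ} → (∀ i → HasCard (S i) (c i)) →
              ∀ n → (∀ {i j x} → i < j → j < n → S i x → S j x → ⊥) →
              HasCard (λ x → ∃ λ i → i < n × S i x) (sum (applyUpTo c n))
  HasCard-⋃ S |S| zero _ = [] , [] , (λ x → (λ ()) , λ ()) , refl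
  HasCard-⋃ S |S| (suc n) disjoint =
    HasCard-resp split⁻¹ split
      (HasCard-⊎ (|S| 0) (HasCard-⋃ (S ∘ suc) (|S| ∘ suc) n (λ i<j j<n → disjoint (s<s i<j) (s<s j<n)))
        λ S₀x (i , i<n , Sᵢ₊₁x) → disjoint z<s (s<s i<n) S₀x Sᵢ₊₁x)
    where
    split : ∀ x → (∃ λ i → i < suc n × S i x) → S 0 x ⊎ (∃ λ i → i < n × S (suc i) x)
    split x (zero  , _         , S₀x) = inj₁ S₀x
    split x (suc i , s<s i<n , Sᵢ₊₁x) = inj₂ (i , i<n , Sᵢ₊₁x)
    split⁻¹ : ∀ x → S 0 x ⊎ (∃ λ i → i < n × S (suc i) x) → ∃ λ i → i < suc n × S i x
    split⁻¹ x (inj₁ S₀x)               = 0 , z<s , S₀x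
    split⁻¹ x (inj₂ (i , i<n , Sᵢ₊₁x)) = suc i , s<s i<n , Sᵢ₊₁x

module ℤₚ-Field (p : ℕ) .{{_ : NonZero p}} (p-prime : Prime p) where
  open Zp p
  open ℤₚ-Ring p

  1ᶻ≢0ᶻ : 1ᶻ ≢ 0ᶻ
  1ᶻ≢0ᶻ = ℕ.1+n≢0 ∘ fromN-injective (ℕ.nonTrivial⇒n>1 p {{prime⇒nonTrivial p-prime}}) (ℕ.>-nonZero⁻¹ p)

  x⊗y≡0⇒x≡0⊎y≡0 : ∀ x y → x ⊗ y ≡ 0ᶻ → x ≡ 0ᶻ ⊎ y ≡ 0ᶻ
  x⊗y≡0⇒x≡0⊎y≡0 x y xy≡0 =
    Sum.map (∣⇒≡0ᶻ x) (∣⇒≡0ᶻ y) (euclidsLemma (toℕ x) (toℕ y) p-prime (≡0ᶻ⇒∣ _ xy≡0))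

  ⊗-≢0 : ∀ {x y} → x ≢ 0ᶻ → y ≢ 0ᶻ → x ⊗ y ≢ 0ᶻ
  ⊗-≢0 {x} {y} x≢0 y≢0 = Sum.[ x≢0 , y≢0 ] ∘ x⊗y≡0⇒x≡0⊎y≡0 x y

  ^^-≢0 : ∀ {x} → x ≢ 0ᶻ → ∀ n → x ^^ n ≢ 0ᶻ
  ^^-≢0 x≢0 zero    = 1ᶻ≢0ᶻ
  ^^-≢0 x≢0 (suc n) = ⊗-≢0 x≢0 (^^-≢0 x≢0 n)

  ⊗-cancelˡ : ∀ {x y z} → x ≢ 0ᶻ → x ⊗ y ≡ x ⊗ z → y ≡ z
  ⊗-cancelˡ {x} {y} {z} x≢0 xy≡xz = Sum.[ ⊥-elim ∘ x≢0 , x∙y⁻¹≈ε⇒x≈y y z ] (x⊗y≡0⇒x≡0⊎y≡0 x (y - z) (begin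
    x ⊗ (y - z)          ≡⟨ x[y-z]≈xy-xz x y z ⟩
    (x ⊗ y) - (x ⊗ z)    ≡⟨ cong (_- (x ⊗ z)) xy≡xz ⟩
    (x ⊗ z) - (x ⊗ z)    ≡⟨ -‿inverseʳ (x ⊗ z) ⟩
    0ᶻ                   ∎))
    where open ≡.≡-Reasoning

  ^^-gap : ∀ {x} → x ≢ 0ᶻ → ∀ i d → x ^^ i ≡ x ^^ (i + d) → x ^^ d ≡ 1ᶻ
  ^^-gap {x} x≢0 i d eq =
    sym (⊗-cancelˡ (^^-≢0 x≢0 i) (trans (*-identityʳ (x ^^ i)) (trans eq (^^-homo-⊗ x i d))))

  x²≡y²⇒x≡y⊎x≡⊖y : ∀ x y → x ⊗ x ≡ y ⊗ y → x ≡ y ⊎ x ≡ ⊖ y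
  x²≡y²⇒x≡y⊎x≡⊖y x y x²≡y² =
    Sum.[ inj₂ ∘ inverseˡ-unique x y , inj₁ ∘ x∙y⁻¹≈ε⇒x≈y x y ] (x⊗y≡0⇒x≡0⊎y≡0 (x ⊕ y) (x - y) (begin
      (x ⊕ y) ⊗ (x - y)                            ≡⟨ x[y-z]≈xy-xz (x ⊕ y) x y ⟩
      ((x ⊕ y) ⊗ x) - ((x ⊕ y) ⊗ y)                ≡⟨ cong₂ _-_ (distribʳ x x y) (distribʳ y x y) ⟩
      ((x ⊗ x) ⊕ (y ⊗ x)) - ((x ⊗ y) ⊕ (y ⊗ y))    ≡⟨ cong₂ (λ a b → (a ⊕ b) - ((x ⊗ y) ⊕ (y ⊗ y))) x²≡y² (⊗-comm y x) ⟩
      ((y ⊗ y) ⊕ (x ⊗ y)) - ((x ⊗ y) ⊕ (y ⊗ y))    ≡⟨ cong (((y ⊗ y) ⊕ (x ⊗ y)) -_) (⊕-comm (x ⊗ y) (y ⊗ y)) ⟩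
      ((y ⊗ y) ⊕ (x ⊗ y)) - ((y ⊗ y) ⊕ (x ⊗ y))    ≡⟨ -‿inverseʳ _ ⟩
      0ᶻ                  ∎))
    where open ≡.≡-Reasoning

-- An odd prime is written 3 + k, so that 2ᶻ ≢ 0ᶻ and 0ᶻ ⁻¹ ≡ 0ᶻ hold by computation.
module OddPrime (k : ℕ) (p-prime : Prime (3 + k)) where
  open Zp (3 + k)
  open ℤₚ-Ring (3 + k)
  open ℤₚ-Field (3 + k) p-prime
  open Cardinality (3 + k)

  2ᶻ≢0ᶻ : 2ᶻ ≢ 0ᶻ
  2ᶻ≢0ᶻ ()

  x≡⊖x⇒x≡0 : ∀ {x} → x ≡ ⊖ x → x ≡ 0ᶻ
  x≡⊖x⇒x≡0 {x} x≡⊖x = Sum.[ ⊥-elim ∘ 2ᶻ≢0ᶻ , id ] (x⊗y≡0⇒x≡0⊎y≡0 2ᶻ x (begin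
    2ᶻ ⊗ x     ≡⟨ solve 1 (λ x → Κ 2ᶻ :* x ⊜ (x :+ x)) refl x ⟩
    x ⊕ x      ≡⟨ cong (x ⊕_) x≡⊖x ⟩
    x - x      ≡⟨ -‿inverseʳ x ⟩
    0ᶻ         ∎))
    where open ≡.≡-Reasoning

  rootsOf : Z → List Z
  rootsOf r with r Fin.≟ 0ᶻ
  ... | yes _ = r ∷ []
  ... | no  _ = r ∷ ⊖ r ∷ []

  rootsOf-sound : ∀ r {s} → s ∈ rootsOf r → s ⊗ s ≡ r ⊗ r
  rootsOf-sound r s∈ with r Fin.≟ 0ᶻ | s∈
  ... | yes _ | here refl         = refl
  ... | no  _ | here refl         = refl
  ... | no  _ | there (here refl) = begin
    (⊖ r) ⊗ (⊖ r)     ≡⟨ -‿distribˡ-* r (⊖ r) ⟨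
    ⊖ (r ⊗ (⊖ r))     ≡⟨ cong ⊖_ (-‿distribʳ-* r r) ⟨
    ⊖ (⊖ (r ⊗ r))     ≡⟨ ⁻¹-involutive (r ⊗ r) ⟩
    r ⊗ r             ∎
    where open ≡.≡-Reasoning

  rootsOf-complete : ∀ r {s} → s ⊗ s ≡ r ⊗ r → s ∈ rootsOf r
  rootsOf-complete r {s} s²≡r² with r Fin.≟ 0ᶻ
  ... | yes refl = here (Sum.reduce (x⊗y≡0⇒x≡0⊎y≡0 s s s²≡r²))
  ... | no  _    = Sum.[ here , there ∘ here ]′ (x²≡y²⇒x≡y⊎x≡⊖y s r s²≡r²)

  rootsOf-unique : ∀ r → Unique (rootsOf r)
  rootsOf-unique r with r Fin.≟ 0ᶻ
  ... | yes _   = [] ∷ []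
  ... | no  r≢0 = ((r≢0 ∘ x≡⊖x⇒x≡0) ∷ []) ∷ [] ∷ []

  length-rootsOf : ∀ {r} → r ≢ 0ᶻ → length (rootsOf r) ≡ 2
  length-rootsOf {r} r≢0 with r Fin.≟ 0ᶻ
  ... | yes r≡0 = ⊥-elim (r≢0 r≡0)
  ... | no  _   = refl

  squareRoots : ∀ {ys} → All IsSquare ys → List Z
  squareRoots []             = []
  squareRoots ((r , _) ∷ sq) = rootsOf r ++ squareRoots sq

  ∈-squareRoots⁻ : ∀ {ys} (sq : All IsSquare ys) {s} → s ∈ squareRoots sq → s ⊗ s ∈ ys
  ∈-squareRoots⁻ ((r , refl) ∷ sq) s∈ with ∈-++⁻ (rootsOf r) s∈
  ... | inj₁ s∈roots = here (rootsOf-sound r s∈roots)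
  ... | inj₂ s∈rest  = there (∈-squareRoots⁻ sq s∈rest)

  ∈-squareRoots⁺ : ∀ {ys} (sq : All IsSquare ys) {s} → s ⊗ s ∈ ys → s ∈ squareRoots sq
  ∈-squareRoots⁺ ((r , refl) ∷ sq) (here s²≡r²) = ∈-++⁺ˡ (rootsOf-complete r s²≡r²)
  ∈-squareRoots⁺ ((r , _) ∷ sq)    (there s²∈)  = ∈-++⁺ʳ (rootsOf r) (∈-squareRoots⁺ sq s²∈)

  squareRoots-unique : ∀ {ys} (sq : All IsSquare ys) → Unique ys → Unique (squareRoots sq)
  squareRoots-unique []               []              = []
  squareRoots-unique ((r , refl) ∷ sq) (r²∉ys ∷ ys!) =
    Unique.++⁺ (rootsOf-unique r) (squareRoots-unique sq ys!) λ (s∈roots , s∈rest) →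
      All.lookup r²∉ys (∈-squareRoots⁻ sq s∈rest) (sym (rootsOf-sound r s∈roots))

  length-squareRoots : ∀ {ys} (sq : All IsSquare ys) → 0ᶻ ∉ ys → length (squareRoots sq) ≡ 2 * length ys
  length-squareRoots []                _   = refl
  length-squareRoots {_ ∷ ys} ((r , refl) ∷ sq) 0∉ys = begin
    length (rootsOf r ++ squareRoots sq)          ≡⟨ length-++ (rootsOf r) ⟩
    length (rootsOf r) + length (squareRoots sq)  ≡⟨ cong₂ _+_ (length-rootsOf r≢0) (length-squareRoots sq (0∉ys ∘ there)) ⟩
    2 + 2 * length ys                             ≡⟨ ℕ.*-suc 2 (length ys) ⟨
    2 * suc (length ys)                           ∎
    where
    open ≡.≡-Reasoning
    r≢0 : r ≢ 0ᶻ
    r≢0 refl = 0∉ys (here refl)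

  length-squareRoots-0∈ : ∀ {ys} (sq : All IsSquare ys) → Unique ys → 0ᶻ ∈ ys →
                          suc (length (squareRoots sq)) ≡ 2 * length ys
  length-squareRoots-0∈ {_ ∷ ys} ((r , refl) ∷ sq) (r²∉ys ∷ _) (here 0≡r²)
    with refl ← Sum.reduce (x⊗y≡0⇒x≡0⊎y≡0 r r (sym 0≡r²)) = begin
    suc (suc (length (squareRoots sq)))   ≡⟨ cong (suc ∘ suc) (length-squareRoots sq λ 0∈ys → All.lookup r²∉ys 0∈ys refl) ⟩
    suc (suc (2 * length ys))             ≡⟨ ℕ.*-suc 2 (length ys) ⟨
    2 * suc (length ys)                   ∎
    where open ≡.≡-Reasoning
  length-squareRoots-0∈ {_ ∷ ys} ((r , refl) ∷ sq) (r²∉ys ∷ ys!) (there 0∈ys) = begin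
    suc (length (rootsOf r ++ squareRoots sq))           ≡⟨ cong suc (length-++ (rootsOf r)) ⟩
    suc (length (rootsOf r) + length (squareRoots sq))   ≡⟨ cong (λ n → suc (n + _)) (length-rootsOf r≢0) ⟩
    2 + suc (length (squareRoots sq))                    ≡⟨ cong (2 +_) (length-squareRoots-0∈ sq ys! 0∈ys) ⟩
    2 + 2 * length ys                                    ≡⟨ ℕ.*-suc 2 (length ys) ⟨
    2 * suc (length ys)                                  ∎
    where
    open ≡.≡-Reasoning
    r≢0 : r ≢ 0ᶻ
    r≢0 refl = All.lookup r²∉ys 0∈ys refl

  HasCard-squareRoots : ∀ {S : Subset} {n m} → HasCard (IsSquare ∩ˢ S) n → S 0ᶻ →
                        HasCard (λ r → S (r ⊗ r)) m → 2 * n ≡ suc m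
  HasCard-squareRoots {S} {m = m} (ys , ys! , ys≐ , refl) S0 |roots| = begin
    2 * length ys                   ≡⟨ length-squareRoots-0∈ sq ys! (proj₂ (ys≐ 0ᶻ) ((0ᶻ , refl) , S0)) ⟨
    suc (length (squareRoots sq))   ≡⟨ cong suc (HasCard-length |roots| (squareRoots-unique sq ys!) sound complete) ⟩
    suc m                           ∎
    where
    open ≡.≡-Reasoning
    sq : All IsSquare ys
    sq = All.tabulate λ {y} y∈ys → proj₁ (proj₁ (ys≐ y) y∈ys)
    sound : ∀ r → r ∈ squareRoots sq → S (r ⊗ r)
    sound r r∈ = proj₂ (proj₁ (ys≐ (r ⊗ r)) (∈-squareRoots⁻ sq r∈))
    complete : ∀ r → S (r ⊗ r) → r ∈ squareRoots sq
    complete r S[r²] = ∈-squareRoots⁺ sq (proj₂ (ys≐ (r ⊗ r)) ((r , refl) , S[r²]))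

  module Cyclic (g : Z) (g-primitive : IsPrimitiveRoot g) where

    g≢0 : g ≢ 0ᶻ
    g≢0 g≡0 with g-primitive 2ᶻ 2ᶻ≢0ᶻ
    ... | zero  , ()
    ... | suc e , 2≡g⊗gᵉ = 2ᶻ≢0ᶻ (trans 2≡g⊗gᵉ (cong (_⊗ (g ^^ e)) g≡0))

    nonzero : List Z
    nonzero = map Fin.suc (allFin (2 + k))

    nonzero-unique : Unique nonzero
    nonzero-unique = Unique.map⁺ suc-injective (Unique.allFin⁺ (2 + k))

    length-nonzero : length nonzero ≡ 2 + k
    length-nonzero = trans (length-map Fin.suc (allFin (2 + k))) (length-tabulate id)

    period-≥ : ∀ {c} → 0 < c → g ^^ c ≡ 1ᶻ → 2 + k ≤ c
    period-≥ {c} 0<c gᶜ≡1 = subst₂ _≤_ length-nonzero (length-applyUpTo (g ^^_) c)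
      (Unique∧⊆⇒length≤ nonzero-unique covered)
      where
      instance
        c-nonZero : NonZero c
        c-nonZero = ℕ.>-nonZero 0<c
      covered : nonzero ⊆ applyUpTo (g ^^_) c
      covered {x} x∈nonzero with _ , _ , refl ← ∈-map⁻ Fin.suc x∈nonzero
        with e , x≡gᵉ ← g-primitive x (λ ())
        = subst (_∈ applyUpTo (g ^^_) c) (sym (trans x≡gᵉ (^^-mod gᶜ≡1 e))) (∈-applyUpTo⁺ (g ^^_) (m%n<n e c))

    private
      0≢gᵉ : ∀ e → 0ᶻ ≢ g ^^ e
      0≢gᵉ e = ^^-≢0 g≢0 e ∘ sym

      nonzeroPower : Fin (3 + k) → Fin (2 + k)
      nonzeroPower e = Fin.punchOut (0≢gᵉ (toℕ e))

    period-exists : ∃ λ c → 0 < c × c ≤ 2 + k × g ^^ c ≡ 1ᶻ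
    period-exists with i , j , i<j , eq ← pigeonhole (ℕ.n<1+n (2 + k)) nonzeroPower =
      toℕ j ∸ toℕ i , ℕ.m<n⇒0<n∸m i<j , ℕ.≤-trans (ℕ.m∸n≤m (toℕ j) (toℕ i)) (ℕ.s≤s⁻¹ (toℕ<n j)) ,
      ^^-gap g≢0 (toℕ i) (toℕ j ∸ toℕ i)
        (trans (punchOut-injective (0≢gᵉ (toℕ i)) (0≢gᵉ (toℕ j)) eq) (cong (g ^^_) (sym (ℕ.m+[n∸m]≡n (ℕ.<⇒≤ i<j)))))

    g^[p-1]≡1 : g ^^ (2 + k) ≡ 1ᶻ
    g^[p-1]≡1 = let c , 0<c , c≤p-1 , gᶜ≡1 = period-exists in
      subst (λ c → g ^^ c ≡ 1ᶻ) (ℕ.≤-antisym c≤p-1 (period-≥ 0<c gᶜ≡1)) gᶜ≡1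

    g^^-injective : ∀ {i j} → i < j → j < 2 + k → g ^^ i ≢ g ^^ j
    g^^-injective {i} {j} i<j j<p-1 gⁱ≡gʲ = ℕ.<-irrefl refl
      (ℕ.≤-<-trans (ℕ.≤-trans (period-≥ (ℕ.m<n⇒0<n∸m i<j) gʲ⁻ⁱ≡1) (ℕ.m∸n≤m j i)) j<p-1)
      where
      gʲ⁻ⁱ≡1 : g ^^ (j ∸ i) ≡ 1ᶻ
      gʲ⁻ⁱ≡1 = ^^-gap g≢0 i (j ∸ i) (trans gⁱ≡gʲ (cong (g ^^_) (sym (ℕ.m+[n∸m]≡n (ℕ.<⇒≤ i<j)))))

    fermat : ∀ {x} → x ≢ 0ᶻ → x ^^ (2 + k) ≡ 1ᶻ
    fermat {x} x≢0 with e , refl ← g-primitive x x≢0 = begin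
      (g ^^ e) ^^ (2 + k)    ≡⟨ ^^-assocʳ g e (2 + k) ⟩
      g ^^ (e * (2 + k))     ≡⟨ cong (g ^^_) (ℕ.*-comm e (2 + k)) ⟩
      g ^^ ((2 + k) * e)     ≡⟨ ^^-assocʳ g (2 + k) e ⟨
      (g ^^ (2 + k)) ^^ e    ≡⟨ cong (_^^ e) g^[p-1]≡1 ⟩
      1ᶻ ^^ e                ≡⟨ 1^^n≡1 e ⟩
      1ᶻ                     ∎
      where open ≡.≡-Reasoning

    -- The Fermat inverse x ^ (p − 2), with the junk value 0 ⁻¹ = 0.
    infix 30 _⁻¹
    _⁻¹ : Z → Z
    x ⁻¹ = x ^^ (1 + k)

    ⁻¹-inverseʳ : ∀ {x} → x ≢ 0ᶻ → x ⊗ x ⁻¹ ≡ 1ᶻ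
    ⁻¹-inverseʳ = fermat

    ⁻¹-unique : ∀ {x y} → x ≢ 0ᶻ → x ⊗ y ≡ 1ᶻ → y ≡ x ⁻¹
    ⁻¹-unique x≢0 xy≡1 = ⊗-cancelˡ x≢0 (trans xy≡1 (sym (⁻¹-inverseʳ x≢0)))

    ⁻¹-≢0 : ∀ {x} → x ≢ 0ᶻ → x ⁻¹ ≢ 0ᶻ
    ⁻¹-≢0 x≢0 = ^^-≢0 x≢0 (1 + k)

    x⊗[x⊗y⁻¹]⁻¹≡y : ∀ {x y} → x ≢ 0ᶻ → y ≢ 0ᶻ → x ⊗ (x ⊗ y ⁻¹) ⁻¹ ≡ y
    x⊗[x⊗y⁻¹]⁻¹≡y {x} {y} x≢0 y≢0 = ⊗-cancelˡ v≢0 (begin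
      v ⊗ (x ⊗ v ⁻¹)     ≡⟨ solve 3 (λ v x w → v :* (x :* w) ⊜ x :* (v :* w)) refl v x (v ⁻¹) ⟩
      x ⊗ (v ⊗ v ⁻¹)     ≡⟨ cong (x ⊗_) (trans (⁻¹-inverseʳ v≢0) (sym (⁻¹-inverseʳ y≢0))) ⟩
      x ⊗ (y ⊗ y ⁻¹)     ≡⟨ solve 3 (λ x y w → x :* (y :* w) ⊜ (x :* w) :* y) refl x y (y ⁻¹) ⟩
      v ⊗ y              ∎)
      where
      open ≡.≡-Reasoning
      v = x ⊗ y ⁻¹
      v≢0 : v ≢ 0ᶻ
      v≢0 = ⊗-≢0 x≢0 (⁻¹-≢0 y≢0)

    module Subgroup (H : Subset) (H-1ᶻ : H 1ᶻ) (H-⊗ : ∀ {x y} → H x → H y → H (x ⊗ y))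
                    (H-≢0 : ∀ {x} → H x → x ≢ 0ᶻ) where

      H-^^ : ∀ {x} → H x → ∀ n → H (x ^^ n)
      H-^^ Hx zero    = H-1ᶻ
      H-^^ Hx (suc n) = H-⊗ Hx (H-^^ Hx n)

      H-⁻¹ : ∀ {x} → H x → H (x ⁻¹)
      H-⁻¹ Hx = H-^^ Hx (1 + k)

      H-cancelʳ : ∀ {x y} → H y → H (x ⊗ y) → H x
      H-cancelʳ {x} {y} Hy Hxy = subst H (begin
        (x ⊗ y) ⊗ y ⁻¹    ≡⟨ ⊗-assoc x y (y ⁻¹) ⟩
        x ⊗ (y ⊗ y ⁻¹)    ≡⟨ cong (x ⊗_) (⁻¹-inverseʳ (H-≢0 Hy)) ⟩
        x ⊗ 1ᶻ            ≡⟨ *-identityʳ x ⟩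
        x                 ∎) (H-⊗ Hxy (H-⁻¹ Hy))
        where open ≡.≡-Reasoning

      H-cancelˡ : ∀ {x y} → H x → H (x ⊗ y) → H y
      H-cancelˡ {x} {y} Hx Hxy = H-cancelʳ Hx (subst H (⊗-comm x y) Hxy)

      ·ˢ-≢0 : ∀ {c x} → c ≢ 0ᶻ → (c ·ˢ H) x → x ≢ 0ᶻ
      ·ˢ-≢0 c≢0 (a , Ha , refl) = ⊗-≢0 c≢0 (H-≢0 Ha)

      square-coset⇒ : ∀ {c x y} → c ≢ 0ᶻ → (c ·ˢ H) x → ((c ⊗ c) ·ˢ H) y → H (y ⊗ (x ⁻¹ ⊗ x ⁻¹))
      square-coset⇒ {c} c≢0 x∈cH@(a , Ha , refl) (b , Hb , refl) =
        subst H y⊗w²≡b⊗a⁻² (H-⊗ Hb (H-⊗ (H-⁻¹ Ha) (H-⁻¹ Ha)))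
        where
        open ≡.≡-Reasoning
        w = (c ⊗ a) ⁻¹
        c⊗w≡a⁻¹ : c ⊗ w ≡ a ⁻¹
        c⊗w≡a⁻¹ = ⁻¹-unique (H-≢0 Ha) (begin
          a ⊗ (c ⊗ w)   ≡⟨ solve 3 (λ a c w → a :* (c :* w) ⊜ (c :* a) :* w) refl a c w ⟩
          (c ⊗ a) ⊗ w   ≡⟨ ⁻¹-inverseʳ (·ˢ-≢0 c≢0 x∈cH) ⟩
          1ᶻ            ∎)
        y⊗w²≡b⊗a⁻² : b ⊗ (a ⁻¹ ⊗ a ⁻¹) ≡ ((c ⊗ c) ⊗ b) ⊗ (w ⊗ w)
        y⊗w²≡b⊗a⁻² = begin
          b ⊗ (a ⁻¹ ⊗ a ⁻¹)               ≡⟨ cong (λ u → b ⊗ (u ⊗ u)) c⊗w≡a⁻¹ ⟨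
          b ⊗ ((c ⊗ w) ⊗ (c ⊗ w))         ≡⟨ solve 3 (λ b c w → b :* ((c :* w) :* (c :* w)) ⊜ ((c :* c) :* b) :* (w :* w)) refl b c w ⟩
          ((c ⊗ c) ⊗ b) ⊗ (w ⊗ w)         ∎

      square-coset⇐ : ∀ {c x y} → c ≢ 0ᶻ → (c ·ˢ H) x → H (y ⊗ (x ⁻¹ ⊗ x ⁻¹)) → ((c ⊗ c) ·ˢ H) y
      square-coset⇐ {c} {y = y} c≢0 x∈cH@(a , Ha , refl) Hyw² =
        (a ⊗ a) ⊗ (y ⊗ (w ⊗ w)) , H-⊗ (H-⊗ Ha Ha) Hyw² , (begin
          y                                       ≡⟨ *-identityʳ y ⟨
          y ⊗ (1ᶻ ⊗ 1ᶻ)                           ≡⟨ cong (λ u → y ⊗ (u ⊗ u)) (⁻¹-inverseʳ (·ˢ-≢0 c≢0 x∈cH)) ⟨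
          y ⊗ (((c ⊗ a) ⊗ w) ⊗ ((c ⊗ a) ⊗ w))     ≡⟨ solve 4 (λ y c a w → y :* (((c :* a) :* w) :* ((c :* a) :* w)) ⊜ (c :* c) :* ((a :* a) :* (y :* (w :* w)))) refl y c a w ⟩
          (c ⊗ c) ⊗ ((a ⊗ a) ⊗ (y ⊗ (w ⊗ w)))     ∎)
        where
        open ≡.≡-Reasoning
        w = (c ⊗ a) ⁻¹

      module Index (ℓ m : ℕ) (|H|≡m : HasCard H m) (ℓ*m≡p-1 : ℓ * m ≡ 2 + k) where

        H? : Decidable H
        H? x = let xs , _ , xs≐H , _ = |H|≡m in
          map′ (proj₁ (xs≐H x)) (proj₂ (xs≐H x)) (any? (x Fin.≟_) xs)

        -- The least d > 0 with g ^ d ∈ H gives H = {g ^ (d j) | j < (p − 1)/d}; comparing with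
        -- |H| = m yields ℓ = d. The search is opaque so that d is never unfolded.
        private
          opaque
            least-d : ∃ λ d → (0 < d × H (g ^^ d)) × (∀ {j} → j < d → ¬ (0 < j × H (g ^^ j)))
            least-d = least-witness (λ d → (0 ℕ.<? d) ×-dec H? (g ^^ d)) {2 + k}
                                    (z<s , subst H (sym g^[p-1]≡1) H-1ᶻ)

          d : ℕ
          d = proj₁ least-d

          0<d : 0 < d
          0<d = proj₁ (proj₁ (proj₂ least-d))

          instance
            d-nonZero : NonZero d
            d-nonZero = ℕ.>-nonZero 0<d

          g^d∈H : H (g ^^ d)
          g^d∈H = proj₂ (proj₁ (proj₂ least-d))

          g^j∉H : ∀ {j} → 0 < j → j < d → ¬ H (g ^^ j)
          g^j∉H 0<j j<d g^j∈H = proj₂ (proj₂ least-d) j<d (0<j , g^j∈H)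

          g^e∈H⇒d∣e : ∀ e → H (g ^^ e) → d ∣ e
          g^e∈H⇒d∣e e g^e∈H = m%n≡0⇒n∣m e d (ℕ.n≤0⇒n≡0 (ℕ.≮⇒≥ λ 0<e%d → g^j∉H 0<e%d (m%n<n e d) g^[e%d]∈H))
            where
            g^[e%d]∈H : H (g ^^ (e % d))
            g^[e%d]∈H = H-cancelʳ (H-^^ g^d∈H (e / d)) (subst H (^^-divMod g e d) g^e∈H)

          q : ℕ
          q = (2 + k) / d

          d*q≡p-1 : d * q ≡ 2 + k
          d*q≡p-1 = m*[n/m]≡n (g^e∈H⇒d∣e (2 + k) (subst H (sym g^[p-1]≡1) H-1ᶻ))

          |H|≡q : HasCard H q
          |H|≡q = applyUpTo gᵈʲ q , Unique.applyUpTo⁺₁ gᵈʲ q distinct , (λ x → sound x , complete x) ,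
                  length-applyUpTo gᵈʲ q
            where
            gᵈʲ : ℕ → Z
            gᵈʲ j = g ^^ (d * j)
            distinct : ∀ {i j} → i < j → j < q → gᵈʲ i ≢ gᵈʲ j
            distinct {j = j} i<j j<q = g^^-injective (ℕ.*-monoʳ-< d i<j) (subst (d * j <_) d*q≡p-1 (ℕ.*-monoʳ-< d j<q))
            sound : ∀ x → x ∈ applyUpTo gᵈʲ q → H x
            sound x x∈ = let j , _ , x≡gᵈʲ = ∈-applyUpTo⁻ gᵈʲ x∈ in
              subst H (trans (^^-assocʳ g d j) (sym x≡gᵈʲ)) (H-^^ g^d∈H j)
            complete : ∀ x → H x → x ∈ applyUpTo gᵈʲ q
            complete x Hx = subst (_∈ applyUpTo gᵈʲ q) (sym x≡gᵈʲ) (∈-applyUpTo⁺ gᵈʲ j<q)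
              where
              e = proj₁ (g-primitive x (H-≢0 Hx))
              r = e % (2 + k)
              x≡gʳ : x ≡ g ^^ r
              x≡gʳ = trans (proj₂ (g-primitive x (H-≢0 Hx))) (^^-mod g^[p-1]≡1 e)
              j = r / d
              d*j≡r : d * j ≡ r
              d*j≡r = m*[n/m]≡n (g^e∈H⇒d∣e r (subst H x≡gʳ Hx))
              j<q : j < q
              j<q = ℕ.*-cancelˡ-< d j q (subst₂ _<_ (sym d*j≡r) (sym d*q≡p-1) (m%n<n e (2 + k)))
              x≡gᵈʲ : x ≡ gᵈʲ j
              x≡gᵈʲ = trans x≡gʳ (cong (g ^^_) (sym d*j≡r))

          ℓ≡d : ℓ ≡ d
          ℓ≡d = ℕ.*-cancelʳ-≡ ℓ d m {{m-nonZero}}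
            (trans ℓ*m≡p-1 (trans (sym d*q≡p-1) (cong (d *_) (HasCard-functional |H|≡q |H|≡m))))
            where
            m-nonZero : NonZero m
            m-nonZero = ℕ.≢-nonZero λ m≡0 → ℕ.0≢1+n (trans (sym (ℕ.*-zeroʳ ℓ)) (trans (cong (ℓ *_) (sym m≡0)) ℓ*m≡p-1))

        instance
          ℓ-nonZero : NonZero ℓ
          ℓ-nonZero = ℕ.>-nonZero (subst (0 <_) (sym ℓ≡d) 0<d)

        cosets-disjoint : ∀ {i j x} → i < j → j < ℓ → ((g ^^ i) ·ˢ H) x → ((g ^^ j) ·ˢ H) x → ⊥
        cosets-disjoint {i} {j} i<j j<ℓ (a , Ha , refl) (b , Hb , gⁱa≡gʲb) =
          g^j∉H (ℕ.m<n⇒0<n∸m i<j) (subst (j ∸ i <_) ℓ≡d (ℕ.≤-<-trans (ℕ.m∸n≤m j i) j<ℓ))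
            (H-cancelʳ Hb (subst H a≡gᵟb Ha))
          where
          open ≡.≡-Reasoning
          a≡gᵟb : a ≡ (g ^^ (j ∸ i)) ⊗ b
          a≡gᵟb = ⊗-cancelˡ (^^-≢0 g≢0 i) (begin
            (g ^^ i) ⊗ a                        ≡⟨ gⁱa≡gʲb ⟩
            (g ^^ j) ⊗ b                        ≡⟨ cong (λ n → (g ^^ n) ⊗ b) (ℕ.m+[n∸m]≡n (ℕ.<⇒≤ i<j)) ⟨
            (g ^^ (i + (j ∸ i))) ⊗ b            ≡⟨ cong (_⊗ b) (^^-homo-⊗ g i (j ∸ i)) ⟩
            ((g ^^ i) ⊗ (g ^^ (j ∸ i))) ⊗ b     ≡⟨ ⊗-assoc (g ^^ i) (g ^^ (j ∸ i)) b ⟩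
            (g ^^ i) ⊗ ((g ^^ (j ∸ i)) ⊗ b)     ∎)

        coset-of : ∀ {x} → x ≢ 0ᶻ → ∃ λ i → i < ℓ × ((g ^^ i) ·ˢ H) x
        coset-of {x} x≢0 = let e , x≡gᵉ = g-primitive x x≢0 in
          e % ℓ , m%n<n e ℓ , (g ^^ ℓ) ^^ (e / ℓ) ,
          H-^^ (subst (λ n → H (g ^^ n)) (sym ℓ≡d) g^d∈H) (e / ℓ) , trans x≡gᵉ (^^-divMod g e ℓ)

    L-1ᶻ : L 1ᶻ
    L-1ᶻ = 0 , 0 , refl

    L-⊗ : ∀ {x y} → L x → L y → L (x ⊗ y)
    L-⊗ (a , b , refl) (c , d , refl) = a + c , b + d , (begin
      (((⊖ 1ᶻ) ^^ a) ⊗ (2ᶻ ^^ b)) ⊗ (((⊖ 1ᶻ) ^^ c) ⊗ (2ᶻ ^^ d))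
        ≡⟨ solve 4 (λ A B C D → (A :* B) :* (C :* D) ⊜ (A :* C) :* (B :* D)) refl ((⊖ 1ᶻ) ^^ a) (2ᶻ ^^ b) ((⊖ 1ᶻ) ^^ c) (2ᶻ ^^ d) ⟩
      (((⊖ 1ᶻ) ^^ a) ⊗ ((⊖ 1ᶻ) ^^ c)) ⊗ ((2ᶻ ^^ b) ⊗ (2ᶻ ^^ d))
        ≡⟨ cong₂ _⊗_ (^^-homo-⊗ (⊖ 1ᶻ) a c) (^^-homo-⊗ 2ᶻ b d) ⟨
      ((⊖ 1ᶻ) ^^ (a + c)) ⊗ (2ᶻ ^^ (b + d))
        ∎)
      where open ≡.≡-Reasoning

    L-≢0 : ∀ {x} → L x → x ≢ 0ᶻ
    L-≢0 (a , b , refl) = ⊗-≢0 (^^-≢0 ⊖1≢0 a) (^^-≢0 2ᶻ≢0ᶻ b)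
      where
      ⊖1≢0 : ⊖ 1ᶻ ≢ 0ᶻ
      ⊖1≢0 ⊖1≡0 = 1ᶻ≢0ᶻ (trans (sym (⊕-identityˡ 1ᶻ)) (trans (cong (_⊕ 1ᶻ) (sym ⊖1≡0)) (⊖-inverseˡ 1ᶻ)))

    L-4 : L 4ᶻ
    L-4 = L-⊗ (0 , 1 , refl) (0 , 1 , refl)

    0∈1+L : (1ᶻ +ˢ L) 0ᶻ
    0∈1+L = ⊖ 1ᶻ , (1 , 0 , sym (trans (*-identityʳ _) (*-identityʳ _))) , sym (-‿inverseʳ 1ᶻ)

    open Subgroup L L-1ᶻ L-⊗ L-≢0

    √[1+L] : Subset
    √[1+L] r = (1ᶻ +ˢ L) (r ⊗ r)

    Block : ℕ → Subset
    Block i = (1ᶻ +ˢ ((g ^^ i) ·ˢ L)) ∩ˢ ((g ^^ (2 * i)) ·ˢ L)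

    -- F t = (t + 1)/(t − 1); it stays an involution at t = 1 since 0 ⁻¹ = 0 gives F 1 = 1.
    F : Z → Z
    F t = 1ᶻ ⊕ (2ᶻ ⊗ (t - 1ᶻ) ⁻¹)

    [1+x]-1≡x : ∀ x → (1ᶻ ⊕ x) - 1ᶻ ≡ x
    [1+x]-1≡x x = begin
      (1ᶻ ⊕ x) - 1ᶻ      ≡⟨ cong (_- 1ᶻ) (⊕-comm 1ᶻ x) ⟩
      (x ⊕ 1ᶻ) - 1ᶻ      ≡⟨ ⊕-assoc x 1ᶻ (⊖ 1ᶻ) ⟩
      x ⊕ (1ᶻ - 1ᶻ)      ≡⟨ cong (x ⊕_) (-‿inverseʳ 1ᶻ) ⟩
      x ⊕ 0ᶻ             ≡⟨ +-identityʳ x ⟩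
      x                  ∎
      where open ≡.≡-Reasoning

    1+[t-1]≡t : ∀ t → 1ᶻ ⊕ (t - 1ᶻ) ≡ t
    1+[t-1]≡t t = begin
      1ᶻ ⊕ (t - 1ᶻ)      ≡⟨ ⊕-comm 1ᶻ (t - 1ᶻ) ⟩
      (t - 1ᶻ) ⊕ 1ᶻ      ≡⟨ ⊕-assoc t (⊖ 1ᶻ) 1ᶻ ⟩
      t ⊕ ((⊖ 1ᶻ) ⊕ 1ᶻ)  ≡⟨ cong (t ⊕_) (⊖-inverseˡ 1ᶻ) ⟩
      t ⊕ 0ᶻ             ≡⟨ +-identityʳ t ⟩
      t                  ∎
      where open ≡.≡-Reasoning

    2⊗[2⊗u⁻¹]⁻¹≡u : ∀ u → 2ᶻ ⊗ (2ᶻ ⊗ u ⁻¹) ⁻¹ ≡ u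
    2⊗[2⊗u⁻¹]⁻¹≡u u with u Fin.≟ 0ᶻ
    ... | yes refl = refl
    ... | no  u≢0  = x⊗[x⊗y⁻¹]⁻¹≡y 2ᶻ≢0ᶻ u≢0

    F-involutive : ∀ t → F (F t) ≡ t
    F-involutive t = begin
      F (F t)                                ≡⟨ cong (λ v → 1ᶻ ⊕ (2ᶻ ⊗ v ⁻¹)) ([1+x]-1≡x (2ᶻ ⊗ (t - 1ᶻ) ⁻¹)) ⟩
      1ᶻ ⊕ (2ᶻ ⊗ (2ᶻ ⊗ (t - 1ᶻ) ⁻¹) ⁻¹)      ≡⟨ cong (1ᶻ ⊕_) (2⊗[2⊗u⁻¹]⁻¹≡u (t - 1ᶻ)) ⟩
      1ᶻ ⊕ (t - 1ᶻ)                          ≡⟨ 1+[t-1]≡t t ⟩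
      t                                      ∎
      where open ≡.≡-Reasoning

    F-injective : ∀ {s t} → F s ≡ F t → s ≡ t
    F-injective {s} {t} Fs≡Ft = trans (sym (F-involutive s)) (trans (cong F Fs≡Ft) (F-involutive t))

    -- Both sides are moved so that no subtraction occurs; then it is a ring identity in 2, x, x⁻¹.
    [1+2x⁻¹]²≡1+4[1+x]x⁻² : ∀ {x} → x ≢ 0ᶻ →
      (1ᶻ ⊕ (2ᶻ ⊗ x ⁻¹)) ⊗ (1ᶻ ⊕ (2ᶻ ⊗ x ⁻¹)) ≡ 1ᶻ ⊕ (4ᶻ ⊗ ((1ᶻ ⊕ x) ⊗ (x ⁻¹ ⊗ x ⁻¹)))
    [1+2x⁻¹]²≡1+4[1+x]x⁻² {x} x≢0 = +-cancelʳ (T ⊗ (T ⊗ (x ⊗ (w ⊗ w)))) _ _ (begin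
      ((1ᶻ ⊕ (T ⊗ w)) ⊗ (1ᶻ ⊕ (T ⊗ w))) ⊕ (T ⊗ (T ⊗ (x ⊗ (w ⊗ w))))
        ≡⟨ solve 3 (λ T x w → (((Κ 1ᶻ :+ T :* w) :* (Κ 1ᶻ :+ T :* w)) :+ T :* (T :* (x :* (w :* w))))
                            ⊜ ((Κ 1ᶻ :+ (T :* T) :* ((Κ 1ᶻ :+ x) :* (w :* w))) :+ (T :* w :+ T :* w))) refl T x w ⟩
      (1ᶻ ⊕ ((T ⊗ T) ⊗ ((1ᶻ ⊕ x) ⊗ (w ⊗ w)))) ⊕ ((T ⊗ w) ⊕ (T ⊗ w))
        ≡⟨ cong ((1ᶻ ⊕ ((T ⊗ T) ⊗ ((1ᶻ ⊕ x) ⊗ (w ⊗ w)))) ⊕_) T²xw²≡2Tw ⟨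
      (1ᶻ ⊕ ((T ⊗ T) ⊗ ((1ᶻ ⊕ x) ⊗ (w ⊗ w)))) ⊕ (T ⊗ (T ⊗ (x ⊗ (w ⊗ w))))
        ∎)
      where
      open ≡.≡-Reasoning
      T = 2ᶻ
      w = x ⁻¹
      T²xw²≡2Tw : T ⊗ (T ⊗ (x ⊗ (w ⊗ w))) ≡ (T ⊗ w) ⊕ (T ⊗ w)
      T²xw²≡2Tw = begin
        T ⊗ (T ⊗ (x ⊗ (w ⊗ w)))            ≡⟨ cong (λ u → T ⊗ (T ⊗ u)) (⊗-assoc x w w) ⟨
        T ⊗ (T ⊗ ((x ⊗ w) ⊗ w))            ≡⟨ cong (λ u → T ⊗ (T ⊗ (u ⊗ w))) (⁻¹-inverseʳ x≢0) ⟩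
        T ⊗ (T ⊗ (1ᶻ ⊗ w))                 ≡⟨ cong (λ u → T ⊗ (T ⊗ u)) (⊗-identityˡ w) ⟩
        (1ᶻ ⊕ 1ᶻ) ⊗ (T ⊗ w)                ≡⟨ distribʳ (T ⊗ w) 1ᶻ 1ᶻ ⟩
        (1ᶻ ⊗ (T ⊗ w)) ⊕ (1ᶻ ⊗ (T ⊗ w))    ≡⟨ cong₂ _⊕_ (⊗-identityˡ (T ⊗ w)) (⊗-identityˡ (T ⊗ w)) ⟩
        (T ⊗ w) ⊕ (T ⊗ w)                  ∎

    √[1+L]-⇔ : ∀ {x} → x ≢ 0ᶻ → √[1+L] (1ᶻ ⊕ (2ᶻ ⊗ x ⁻¹)) ⇔ L ((1ᶻ ⊕ x) ⊗ (x ⁻¹ ⊗ x ⁻¹))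
    √[1+L]-⇔ {x} x≢0 = mk⇔
      (λ (z , Lz , r²≡1+z) → H-cancelˡ L-4 (subst L (+-cancelˡ 1ᶻ _ _ (trans (sym r²≡1+z) r²≡1+4v)) Lz))
      (λ Lv → _ , L-⊗ L-4 Lv , r²≡1+4v)
      where
      r²≡1+4v = [1+2x⁻¹]²≡1+4[1+x]x⁻² x≢0

    Block⇒√[1+L] : ∀ {i t} → Block i t → √[1+L] (F t)
    Block⇒√[1+L] {i} ((x , x∈gⁱL , refl) , 1+x∈g²ⁱL) =
      subst √[1+L] (sym (cong (λ u → 1ᶻ ⊕ (2ᶻ ⊗ u ⁻¹)) ([1+x]-1≡x x)))
        (Equivalence.from (√[1+L]-⇔ (·ˢ-≢0 gⁱ≢0 x∈gⁱL))
          (square-coset⇒ gⁱ≢0 x∈gⁱL (subst (λ c → (c ·ˢ L) (1ᶻ ⊕ x)) (^^-double g i) 1+x∈g²ⁱL)))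
      where
      gⁱ≢0 : g ^^ i ≢ 0ᶻ
      gⁱ≢0 = ^^-≢0 g≢0 i

    module Count (ℓ m : ℕ) (|L|≡m : HasCard L m) (ℓ*m≡p-1 : ℓ * m ≡ 2 + k) where
      open Index ℓ m |L|≡m ℓ*m≡p-1

      √[1+L]⇒Block : ∀ {r} → √[1+L] r → ∃ λ i → i < ℓ × Block i (F r)
      √[1+L]⇒Block {r} r∈√[1+L]@(z , Lz , r²≡1+z) =
        let i , i<ℓ , x∈gⁱL = coset-of x≢0 in i , i<ℓ , (x , x∈gⁱL , refl) , 1+x∈g²ⁱL {i} x∈gⁱL
        where
        u = r - 1ᶻ
        u≢0 : u ≢ 0ᶻ
        u≢0 u≡0 = L-≢0 Lz (+-cancelˡ 1ᶻ z 0ᶻ (trans (sym r²≡1+z) (cong (λ v → v ⊗ v) r≡1)))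
          where
          r≡1 : r ≡ 1ᶻ
          r≡1 = trans (sym (1+[t-1]≡t r)) (cong (1ᶻ ⊕_) u≡0)
        x = 2ᶻ ⊗ u ⁻¹
        x≢0 : x ≢ 0ᶻ
        x≢0 = ⊗-≢0 2ᶻ≢0ᶻ (⁻¹-≢0 u≢0)
        r≡1+2x⁻¹ : r ≡ 1ᶻ ⊕ (2ᶻ ⊗ x ⁻¹)
        r≡1+2x⁻¹ = trans (sym (1+[t-1]≡t r)) (cong (1ᶻ ⊕_) (sym (2⊗[2⊗u⁻¹]⁻¹≡u u)))
        1+x∈g²ⁱL : ∀ {i} → ((g ^^ i) ·ˢ L) x → ((g ^^ (2 * i)) ·ˢ L) (1ᶻ ⊕ x)
        1+x∈g²ⁱL {i} x∈gⁱL = subst (λ c → (c ·ˢ L) (1ᶻ ⊕ x)) (sym (^^-double g i))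
          (square-coset⇐ (^^-≢0 g≢0 i) x∈gⁱL (Equivalence.to (√[1+L]-⇔ x≢0) (subst √[1+L] r≡1+2x⁻¹ r∈√[1+L])))

      blocks-disjoint : ∀ {i j t} → i < j → j < ℓ → Block i t → Block j t → ⊥
      blocks-disjoint {j = j} i<j j<ℓ ((x , x∈gⁱL , refl) , _) ((y , y∈gʲL , 1+x≡1+y) , _) =
        cosets-disjoint i<j j<ℓ x∈gⁱL (subst ((g ^^ j) ·ˢ L) (sym (+-cancelˡ 1ᶻ x y 1+x≡1+y)) y∈gʲL)

      HasCard-√[1+L] : ∀ {c : ℕ → ℕ} → (∀ i → HasCard (Block i) (c i)) → HasCard √[1+L] (sum (applyUpTo c ℓ))
      HasCard-√[1+L] |Block| = HasCard-image F F-injective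
        (λ t (i , _ , t∈Block) → Block⇒√[1+L] {i} {t} t∈Block)
        (λ r r∈√[1+L] → F r , √[1+L]⇒Block {r} r∈√[1+L] , sym (F-involutive r))
        (HasCard-⋃ Block |Block| ℓ blocks-disjoint)

gcd[i,ℓ]≡1 : ∀ {i ℓ} → Prime ℓ → 0 < i → i < ℓ → gcd i ℓ ≡ 1
gcd[i,ℓ]≡1 {suc i} {ℓ} ℓ-prime _ i<ℓ with prime⇒irreducible ℓ-prime (gcd[m,n]∣n (suc i) ℓ)
... | inj₁ gcd≡1 = gcd≡1
... | inj₂ gcd≡ℓ = ⊥-elim (ℕ.<⇒≱ i<ℓ (∣⇒≤ (subst (_∣ suc i) gcd≡ℓ (gcd[m,n]∣m (suc i) ℓ))))

gcd[ℓ,ℓ]≢1 : ∀ {ℓ} → Prime ℓ → gcd ℓ ℓ ≢ 1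
gcd[ℓ,ℓ]≢1 ℓ-prime gcd≡1 =
  ℕ.nonTrivial⇒≢1 {{prime⇒nonTrivial ℓ-prime}} (gcd≡1⇒coprime gcd≡1 (∣-refl , ∣-refl))

sum[A[i,2i]]≡A[0,0]+sℓ : ∀ {ℓ} → Prime ℓ → (A : ℕ → ℕ → ℕ) → sum (applyUpTo (λ i → A i (2 * i)) ℓ) ≡ A 0 0 + sℓ A ℓ
sum[A[i,2i]]≡A[0,0]+sℓ {zero}  ℓ-prime A = ⊥-elim (ℕ.≢-nonZero⁻¹ 0 {{prime⇒nonZero ℓ-prime}} refl)
sum[A[i,2i]]≡A[0,0]+sℓ {suc l} ℓ-prime A = cong (A 0 0 +_) (begin
  sum (applyUpTo (h ∘ suc) l)                               ≡⟨ cong sum (applyUpTo-cong l (sym ∘ coprime-term)) ⟩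
  sum (applyUpTo (term ∘ suc) l)                            ≡⟨ ℕ.+-identityʳ _ ⟨
  sum (applyUpTo (term ∘ suc) l) + 0                        ≡⟨ cong (λ n → sum (applyUpTo (term ∘ suc) l) + (n + 0)) last-term ⟨
  sum (applyUpTo (term ∘ suc) l) + (term (suc l) + 0)       ≡⟨ sum-++ (applyUpTo (term ∘ suc) l) (term (suc l) ∷ []) ⟨
  sum (applyUpTo (term ∘ suc) l ∷ʳ term (suc l))            ≡⟨ cong sum (applyUpTo-∷ʳ (term ∘ suc) l) ⟩
  sum (applyUpTo (term ∘ suc) (suc l))                      ≡⟨ cong sum (map-applyUpTo suc term (suc l)) ⟨
  sℓ A (suc l)                                              ∎)
  where
  open ≡.≡-Reasoning
  h term : ℕ → ℕ
  h i = A i (2 * i)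
  term i = if does (gcd i (suc l) ℕ.≟ 1) then h i else 0
  coprime-term : ∀ {i} → i < l → term (suc i) ≡ h (suc i)
  coprime-term {i} i<l = cong (λ b → if b then h (suc i) else 0)
    (dec-true (gcd (suc i) (suc l) ℕ.≟ 1) (gcd[i,ℓ]≡1 ℓ-prime z<s (s<s i<l)))
  last-term : term (suc l) ≡ 0
  last-term = cong (λ b → if b then h (suc l) else 0)
    (dec-false (gcd (suc l) (suc l) ℕ.≟ 1) (gcd[ℓ,ℓ]≢1 ℓ-prime))

proposition4p4 : (p : ℕ) .{{_ : NonZero p}} → Prime p → p ≢ 2 →
    let open Zp p in
    (ℓ m : ℕ) → HasCard L m → ℓ * m ≡ p ∸ 1 →
    (g : Z) → IsPrimitiveRoot g →
    (A : ℕ → ℕ → ℕ) →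
    (∀ i j → HasCard ((fromN 1 +ˢ ((g ^^ i) ·ˢ L)) ∩ˢ ((g ^^ j) ·ˢ L)) (A i j)) →
    Prime ℓ → ℓ ≢ 2 →
    (N : ℕ) → HasCard (IsSquare ∩ˢ (fromN 1 +ˢ L)) N →
    2 * N ≡ 1 + A 0 0 + sℓ A ℓ
proposition4p4 0 0-prime _ = ⊥-elim (NonZero.nonZero (prime⇒nonZero 0-prime))
proposition4p4 1 1-prime _ = ⊥-elim (NonTrivial.nonTrivial (prime⇒nonTrivial 1-prime))
proposition4p4 2 _ p≢2 = ⊥-elim (p≢2 refl)
proposition4p4 (suc (suc (suc k))) p-prime _ ℓ m |L|≡m ℓ*m≡p-1 g g-primitive A |Blockᵢⱼ| ℓ-prime _ N |□∩[1+L]| =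
  begin
  2 * N                                          ≡⟨ HasCard-squareRoots |□∩[1+L]| 0∈1+L (HasCard-√[1+L] λ i → |Blockᵢⱼ| i (2 * i)) ⟩
  suc (sum (applyUpTo (λ i → A i (2 * i)) ℓ))    ≡⟨ cong suc (sum[A[i,2i]]≡A[0,0]+sℓ ℓ-prime A) ⟩
  1 + A 0 0 + sℓ A ℓ                             ∎
  where
  open ≡.≡-Reasoning
  open OddPrime k p-prime
  open Cyclic g g-primitive
  open Count ℓ m |L|≡m ℓ*m≡p-1
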